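{- Let $\mathcal{G}:V\to C$ be an effectful graph. Then the data $\mathscr{F}\mathcal{G}:\mathcal{F}_{\otimes}V\to\mathcal{F}C$ (the free strict monoidal category on $V$, the free strict premonoidal category on $C$, and the identity-on-objects functor defined by structural induction with $\mathscr{F}\mathcal{G}(v) = \,\triangleright \mathcal{G}(v)\triangleleft$ on generators and $\mathscr{F}\mathcal{G}(g_1\otimes g_2) = (\mathscr{F}\mathcal{G}(g_1)\rtimes A_2) ; (B_1\ltimes \mathscr{F}\mathcal{G}(g_2))$ for $g_i:A_i\to B_i$) is well defined and forms an effectful category; i.e. $\mathscr{F}\mathcal{G}$ is a strict premonoidal functor whose image consists of central morphisms.
   Context: Composition is diagrammatic ($u;v$ = first $u$ then $v$). A monoidal graph $M$: set of objects $V_M$, set of arrows $E_M$, source/target functions $\delta_0,\delta_1:E_M\to V_M^*$ (lists). A morphism of monoidal graphs consists of maps on objects and arrows commuting with sources and targets. A device graph $C$: a monoidal graph $|C|$, a set of devices, and $\mathsf{dev}_C$ assigning to each arrow a subset of devices. An effectful graph $\mathcal{G}:V\to C$ consists of a monoidal graph $V$, a device graph $C$ with the same objects, and an identity-on-objects morphism of monoidal graphs $\mathcal{G}:V\to|C|$ with $\mathsf{dev}_C(\mathcal{G}v)=\varnothing$ for all arrows $v$ of $V$. A strict premonoidal category: a category whose objects form a strict monoid $(\otimes, I)$, with functors $A\ltimes-$ and $-\rtimes A$ for each object $A$ agreeing with $A\otimes -$, $-\otimes A$ on objects and satisfying $(A\ltimes f)\rtimes B = A\ltimes(f\rtimes B)$,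 $I\ltimes f=f=f\rtimes I$, $(A\otimes B)\ltimes f = A\ltimes(B\ltimes f)$, $f\rtimes(A\otimes B)=(f\rtimes A)\rtimes B$. A strict premonoidal functor is a functor that is a monoid homomorphism on objects and preserves left and right whiskerings. Morphisms $f:A\to B$, $g:A'\to B'$ interchange if $(f\rtimes A');(B\ltimes g)=(A\ltimes g);(f\rtimes B')$ and $(g\rtimes A);(B'\ltimes f)=(A'\ltimes f);(g\rtimes B)$; $f$ is central if it interchanges with every morphism. An effectful category consists of a strict monoidal category $\mathbb{V}$, a strict premonoidal category $\mathbb{C}$ with the same objects, and an identity-on-objects strict premonoidal functor $\mathbb{V}\to\mathbb{C}$ (a strict monoidal category being regarded as strict premonoidal with whiskerings $A\otimes -$, $-\otimes A$) whose image is central. The free strict monoidal category $\mathcal{F}_\otimes V$ has objects $V_V^*$ and morphisms generated by arrows of $V$, identities, composition and tensor $\otimes$, modulo the strict monoidal category axioms. The free strict premonoidal category $\mathcal{F}C$ has objects $V_C^*$ (concatenation $\otimes$, empty list $I$) and morphisms generated by identities, whiskered generators $X\triangleright g\triangleleft Y:X\otimes W\otimes Y\to X\otimes Z\otimes Y$ ($g:W\to Z$ an arrow of $C$, $X,Y$ lists) and composition, modulo associativity/unit laws and, for arrows $f:U\to V'$, $g:U'\to V''$ of $C$ with disjoint device sets, the interchange equation $(X\triangleright f\triangleleft Y\otimes U'\otimes Z);(X\otimes V'\otimes Y\triangleright g\triangleleft Z) = (X\otimes U\otimes Y\triangleright g\triangleleft Z);(X\triangleright f\triangleleft Y\otimes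 V''\otimes Z)$; whiskering by a list acts by concatenating onto the outer whiskers of each generator. -}

module Defs where

open import Level using (0ℓ)
open import Data.Product using (_×_)
open import Data.List using (List; []; _++_)
open import Data.List.Properties using (++-assoc; ++-identityʳ)
open import Relation.Unary using (Pred; _∈_; _∉_; Empty; _∩_)
open import Relation.Binary.PropositionalEquality
  using (_≡_; refl; sym; trans; cong; subst₂)

record MonoidalGraph (Obj : Set) : Set₁ where
  field
    Arr : Set
    src : Arr → List Obj
    tgt : Arr → List Obj

record DeviceGraph (Obj : Set) : Set₁ where
  field
    graph : MonoidalGraph Obj
    Dev   : Set
  open MonoidalGraph graph public
  field
    dev   : Arr → Pred Dev 0ℓ

record EffectfulGraph : Set₁ where
  field
    Obj : Set
    V   : MonoidalGraph Obj
    C   : DeviceGraph Obj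
  module V = MonoidalGraph V
  module C = DeviceGraph C
  field
    G     : V.Arr → C.Arr
    G-src : ∀ v → C.src (G v) ≡ V.src v
    G-tgt : ∀ v → C.tgt (G v) ≡ V.tgt v
    G-dev : ∀ v → Empty (C.dev (G v))

assoc3 : {O : Set} (X U Y W : List O) → (X ++ U ++ Y) ++ W ≡ X ++ U ++ Y ++ W
assoc3 X U Y W = trans (++-assoc X (U ++ Y) W) (cong (X ++_) (++-assoc U Y W))

module Free (𝒢 : EffectfulGraph) where
  open EffectfulGraph 𝒢

  -- The free strict monoidal category F⊗ V (terms modulo ≈)

  infixr 5 _⊗_
  infixr 4 _⨟_

  data Tm : List Obj → List Obj → Set where
    gen : (v : V.Arr) → Tm (V.src v) (V.tgt v)
    id  : (A : List Obj) → Tm A A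
    _⨟_ : ∀ {A B D} → Tm A B → Tm B D → Tm A D
    _⊗_ : ∀ {A B A′ B′} → Tm A B → Tm A′ B′ → Tm (A ++ A′) (B ++ B′)

  cast : ∀ {A A′ B B′} → A ≡ A′ → B ≡ B′ → Tm A B → Tm A′ B′
  cast = subst₂ Tm

  infix 3 _≈_
  data _≈_ : ∀ {A B} → Tm A B → Tm A B → Set where
    ≈-refl  : ∀ {A B} {f : Tm A B} → f ≈ f
    ≈-sym   : ∀ {A B} {f g : Tm A B} → f ≈ g → g ≈ f
    ≈-trans : ∀ {A B} {f g h : Tm A B} → f ≈ g → g ≈ h → f ≈ h
    ⨟-cong  : ∀ {A B D} {f f′ : Tm A B} {g g′ : Tm B D} →
              f ≈ f′ → g ≈ g′ → (f ⨟ g) ≈ (f′ ⨟ g′)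
    ⊗-cong  : ∀ {A B A′ B′} {f f′ : Tm A B} {g g′ : Tm A′ B′} →
              f ≈ f′ → g ≈ g′ → (f ⊗ g) ≈ (f′ ⊗ g′)
    ⨟-assoc : ∀ {A B D E} (f : Tm A B) (g : Tm B D) (h : Tm D E) →
              ((f ⨟ g) ⨟ h) ≈ (f ⨟ (g ⨟ h))
    ⨟-idˡ   : ∀ {A B} (f : Tm A B) → (id A ⨟ f) ≈ f
    ⨟-idʳ   : ∀ {A B} (f : Tm A B) → (f ⨟ id B) ≈ f
    ⊗-id    : (A B : List Obj) → (id A ⊗ id B) ≈ id (A ++ B)
    ⊗-⨟     : ∀ {A B D A′ B′ D′} (f : Tm A B) (g : Tm B D)
                (f′ : Tm A′ B′) (g′ : Tm B′ D′) →
              ((f ⨟ g) ⊗ (f′ ⨟ g′)) ≈ ((f ⊗ f′) ⨟ (g ⊗ g′))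
    ⊗-assoc : ∀ {A B A′ B′ A″ B″} (f : Tm A B) (g : Tm A′ B′) (h : Tm A″ B″) →
              cast (++-assoc A A′ A″) (++-assoc B B′ B″) ((f ⊗ g) ⊗ h)
                ≈ (f ⊗ (g ⊗ h))
    ⊗-unitˡ : ∀ {A B} (f : Tm A B) → (id [] ⊗ f) ≈ f
    ⊗-unitʳ : ∀ {A B} (f : Tm A B) →
              cast (++-identityʳ A) (++-identityʳ B) (f ⊗ id []) ≈ f

  -- The free strict premonoidal category F C (terms modulo ≈P)

  infixr 4 _⨾_

  data PTm : List Obj → List Obj → Set where
    pid   : (A : List Obj) → PTm A A
    whisk : (X : List Obj) (g : C.Arr) (Y : List Obj) →
            PTm (X ++ C.src g ++ Y) (X ++ C.tgt g ++ Y)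
    _⨾_   : ∀ {A B D} → PTm A B → PTm B D → PTm A D

  castP : ∀ {A A′ B B′} → A ≡ A′ → B ≡ B′ → PTm A B → PTm A′ B′
  castP = subst₂ PTm

  infix 3 _≈P_
  data _≈P_ : ∀ {A B} → PTm A B → PTm A B → Set where
    ≈P-refl  : ∀ {A B} {f : PTm A B} → f ≈P f
    ≈P-sym   : ∀ {A B} {f g : PTm A B} → f ≈P g → g ≈P f
    ≈P-trans : ∀ {A B} {f g h : PTm A B} → f ≈P g → g ≈P h → f ≈P h
    ⨾-cong   : ∀ {A B D} {f f′ : PTm A B} {g g′ : PTm B D} →
               f ≈P f′ → g ≈P g′ → (f ⨾ g) ≈P (f′ ⨾ g′)
    ⨾-assoc  : ∀ {A B D E} (f : PTm A B) (g : PTm B D) (h : PTm D E) →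
               ((f ⨾ g) ⨾ h) ≈P (f ⨾ (g ⨾ h))
    ⨾-idˡ    : ∀ {A B} (f : PTm A B) → (pid A ⨾ f) ≈P f
    ⨾-idʳ    : ∀ {A B} (f : PTm A B) → (f ⨾ pid B) ≈P f
    interchange : (X Y Z : List Obj) (f g : C.Arr) →
      Empty (C.dev f ∩ C.dev g) →
      (whisk X f (Y ++ C.src g ++ Z)
         ⨾ castP (assoc3 X (C.tgt f) Y (C.src g ++ Z))
                 (assoc3 X (C.tgt f) Y (C.tgt g ++ Z))
                 (whisk (X ++ C.tgt f ++ Y) g Z))
      ≈P
      (castP (assoc3 X (C.src f) Y (C.src g ++ Z))
             (assoc3 X (C.src f) Y (C.tgt g ++ Z))
             (whisk (X ++ C.src f ++ Y) g Z)
         ⨾ whisk X f (Y ++ C.tgt g ++ Z))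

  _⋉_ : ∀ {B D} (A : List Obj) → PTm B D → PTm (A ++ B) (A ++ D)
  A ⋉ pid B         = pid (A ++ B)
  A ⋉ whisk X g Y   = castP (++-assoc A X (C.src g ++ Y)) (++-assoc A X (C.tgt g ++ Y))
                            (whisk (A ++ X) g Y)
  A ⋉ (f ⨾ g)       = (A ⋉ f) ⨾ (A ⋉ g)

  _⋊_ : ∀ {B D} → PTm B D → (A : List Obj) → PTm (B ++ A) (D ++ A)
  pid B       ⋊ A = pid (B ++ A)
  whisk X g Y ⋊ A = castP (sym (assoc3 X (C.src g) Y A)) (sym (assoc3 X (C.tgt g) Y A))
                          (whisk X g (Y ++ A))
  (f ⨾ g)     ⋊ A = (f ⋊ A) ⨾ (g ⋊ A)

  Interchange : ∀ {A B A′ B′} → PTm A B → PTm A′ B′ → Set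
  Interchange {A} {B} {A′} {B′} f g =
    (((f ⋊ A′) ⨾ (B ⋉ g)) ≈P ((A ⋉ g) ⨾ (f ⋊ B′))) ×
    (((g ⋊ A) ⨾ (B′ ⋉ f)) ≈P ((A′ ⋉ f) ⨾ (g ⋊ B)))

  𝓕𝒢 : ∀ {A B} → Tm A B → PTm A B
  𝓕𝒢 (gen v) = castP (trans (++-identityʳ (C.src (G v))) (G-src v))
                     (trans (++-identityʳ (C.tgt (G v))) (G-tgt v))
                     (whisk [] (G v) [])
  𝓕𝒢 (id A)  = pid A
  𝓕𝒢 (f ⨟ g) = 𝓕𝒢 f ⨾ 𝓕𝒢 g
  𝓕𝒢 (_⊗_ {A₁} {B₁} {A₂} {B₂} f g) = (𝓕𝒢 f ⋊ A₂) ⨾ (B₁ ⋉ 𝓕𝒢 g)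

  -- What it means for 𝓕𝒢 to be well defined and form an effectful category:
  -- a well-defined strict premonoidal functor (identity on objects, hence a
  -- monoid homomorphism on objects) whose image is central.
  record IsEffectfulCategory : Set where
    field
      well-defined : ∀ {A B} {f g : Tm A B} → f ≈ g → 𝓕𝒢 f ≈P 𝓕𝒢 g
      pres-id      : (A : List Obj) → 𝓕𝒢 (id A) ≈P pid A
      pres-comp    : ∀ {A B D} (f : Tm A B) (g : Tm B D) →
                     𝓕𝒢 (f ⨟ g) ≈P (𝓕𝒢 f ⨾ 𝓕𝒢 g)
      pres-⋉       : ∀ {B D} (A : List Obj) (f : Tm B D) →
                     𝓕𝒢 (id A ⊗ f) ≈P (A ⋉ 𝓕𝒢 f)
      pres-⋊       : ∀ {B D} (f : Tm B D) (A : List Obj) →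
                     𝓕𝒢 (f ⊗ id A) ≈P (𝓕𝒢 f ⋊ A)
      central      : ∀ {A B A′ B′} (f : Tm A B) (g : PTm A′ B′) →
                     Interchange (𝓕𝒢 f) g

{-# OPTIONS --safe #-}
module Submission where

open import Defs
open import Data.Product using (_,_; proj₁; proj₂; swap)
open import Data.List using (List; []; _++_)
open import Data.List.Properties using (++-assoc; ++-identityʳ)
open import Function using (_∘_)
open import Relation.Unary using (Empty; _∩_)
open import Relation.Binary.PropositionalEquality using (_≡_; refl; sym; trans)

-- Whiskering in F C respects ≈P, because a whiskered instance of the
-- interchange axiom is again an instance of it, and it satisfies the strict
-- premonoidal laws up to transport of boundaries along list associativity.
-- A whiskered generator without devices interchanges with every whiskered
-- generator by the interchange axiom, and centrality is closed under
-- composition and whiskering, so every 𝓕𝒢 f is central.  The equations of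
-- F⊗ V are then respected one by one; the only substantial one,
-- (f ⨟ g) ⊗ (f′ ⨟ g′) = (f ⊗ f′) ⨟ (g ⊗ g′), is exactly the interchange of
-- 𝓕𝒢 f′ with 𝓕𝒢 g.

module _ (𝒢 : EffectfulGraph) where
  open EffectfulGraph 𝒢
  open Free 𝒢

  infix 3 _≋_
  data _≋_ {A B A′ B′ : List Obj} (f : PTm A B) (g : PTm A′ B′) : Set where
    ≋-by : (p : A ≡ A′) (q : B ≡ B′) → castP p q f ≈P g → f ≋ g

  ≋-refl : ∀ {A B} {f : PTm A B} → f ≋ f
  ≋-refl = ≋-by refl refl ≈P-refl

  ≋-sym : ∀ {A B A′ B′} {f : PTm A B} {g : PTm A′ B′} → f ≋ g → g ≋ f
  ≋-sym (≋-by refl refl f≈g) = ≋-by refl refl (≈P-sym f≈g)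

  ≋-trans : ∀ {A B A′ B′ A″ B″} {f : PTm A B} {g : PTm A′ B′} {h : PTm A″ B″} →
            f ≋ g → g ≋ h → f ≋ h
  ≋-trans (≋-by refl refl f≈g) (≋-by refl refl g≈h) = ≋-by refl refl (≈P-trans f≈g g≈h)

  ≈P⇒≋ : ∀ {A B} {f g : PTm A B} → f ≈P g → f ≋ g
  ≈P⇒≋ = ≋-by refl refl

  ≋⇒≈P : ∀ {A B} {f g : PTm A B} → f ≋ g → f ≈P g
  ≋⇒≈P (≋-by refl refl f≈g) = f≈g

  module ≋-Reasoning where
    infix  1 begin_
    infixr 2 _≋⟨_⟩_ _≋˘⟨_⟩_ _≈⟨_⟩_
    infix  3 _∎

    begin_ : ∀ {A B} {f g : PTm A B} → f ≋ g → f ≈P g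
    begin_ = ≋⇒≈P

    _≋⟨_⟩_ : ∀ {A B A′ B′ A″ B″} (f : PTm A B) {g : PTm A′ B′} {h : PTm A″ B″} →
             f ≋ g → g ≋ h → f ≋ h
    f ≋⟨ f≋g ⟩ g≋h = ≋-trans f≋g g≋h

    _≋˘⟨_⟩_ : ∀ {A B A′ B′ A″ B″} (f : PTm A B) {g : PTm A′ B′} {h : PTm A″ B″} →
              g ≋ f → g ≋ h → f ≋ h
    f ≋˘⟨ g≋f ⟩ g≋h = ≋-trans (≋-sym g≋f) g≋h

    _≈⟨_⟩_ : ∀ {A B A′ B′} (f : PTm A B) {g : PTm A B} {h : PTm A′ B′} →
             f ≈P g → g ≋ h → f ≋ h
    f ≈⟨ f≈g ⟩ g≋h = ≋-trans (≈P⇒≋ f≈g) g≋h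

    _∎ : ∀ {A B} (f : PTm A B) → f ≋ f
    f ∎ = ≋-refl

  castP-≋ : ∀ {A B A′ B′} (p : A ≡ A′) (q : B ≡ B′) (f : PTm A B) → castP p q f ≋ f
  castP-≋ refl refl f = ≋-refl

  ≋-⨾ : ∀ {A B D A′ B′ D′} {f : PTm A B} {g : PTm B D} {f′ : PTm A′ B′} {g′ : PTm B′ D′} →
        f ≋ f′ → g ≋ g′ → (f ⨾ g) ≋ (f′ ⨾ g′)
  ≋-⨾ (≋-by refl refl f≈f′) (≋-by refl refl g≈g′) = ≋-by refl refl (⨾-cong f≈f′ g≈g′)

  ≋-whisk : ∀ {X X′ Y Y′} (a : C.Arr) → X ≡ X′ → Y ≡ Y′ → whisk X a Y ≋ whisk X′ a Y′
  ≋-whisk a refl refl = ≋-refl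

  ≋-pid : ∀ {A A′} → A ≡ A′ → pid A ≋ pid A′
  ≋-pid refl = ≋-refl

  ⋉-castP : ∀ {B D B′ D′} (A : List Obj) (p : B ≡ B′) (q : D ≡ D′) (f : PTm B D) →
            (A ⋉ castP p q f) ≋ (A ⋉ f)
  ⋉-castP A refl refl f = ≋-refl

  castP-⋊ : ∀ {B D B′ D′} (A : List Obj) (p : B ≡ B′) (q : D ≡ D′) (f : PTm B D) →
            (castP p q f ⋊ A) ≋ (f ⋊ A)
  castP-⋊ A refl refl f = ≋-refl

  ⋉-whisk : ∀ (A X : List Obj) (g : C.Arr) (Y : List Obj) →
            (A ⋉ whisk X g Y) ≋ whisk (A ++ X) g Y
  ⋉-whisk A X g Y = castP-≋ _ _ (whisk (A ++ X) g Y)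

  whisk-⋊ : ∀ (X : List Obj) (g : C.Arr) (Y A : List Obj) →
            (whisk X g Y ⋊ A) ≋ whisk X g (Y ++ A)
  whisk-⋊ X g Y A = castP-≋ _ _ (whisk X g (Y ++ A))

  interchange-≋ : ∀ {a b} X Y Z → Empty (C.dev a ∩ C.dev b) →
    ∀ {S M T S′ M′ T′} {f₁ : PTm S M} {f₂ : PTm M T} {g₁ : PTm S′ M′} {g₂ : PTm M′ T′} →
    f₁ ≋ whisk X a (Y ++ C.src b ++ Z) → f₂ ≋ whisk (X ++ C.tgt a ++ Y) b Z →
    g₁ ≋ whisk (X ++ C.src a ++ Y) b Z → g₂ ≋ whisk X a (Y ++ C.tgt b ++ Z) →
    (f₁ ⨾ f₂) ≋ (g₁ ⨾ g₂)
  interchange-≋ {a} {b} X Y Z disjoint f₁≋ f₂≋ g₁≋ g₂≋ =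
    ≋-trans (≋-⨾ f₁≋ (≋-trans f₂≋ (≋-sym (castP-≋ _ _ _))))
      (≋-trans (≈P⇒≋ (interchange X Y Z a b disjoint))
        (≋-⨾ (≋-trans (castP-≋ _ _ _) (≋-sym g₁≋)) (≋-sym g₂≋)))

  ⋉-cong : ∀ (A : List Obj) {B D} {f g : PTm B D} → f ≈P g → (A ⋉ f) ≈P (A ⋉ g)
  ⋉-cong A ≈P-refl                         = ≈P-refl
  ⋉-cong A (≈P-sym f≈g)                    = ≈P-sym (⋉-cong A f≈g)
  ⋉-cong A (≈P-trans f≈g g≈h)              = ≈P-trans (⋉-cong A f≈g) (⋉-cong A g≈h)
  ⋉-cong A (⨾-cong f≈f′ g≈g′)              = ⨾-cong (⋉-cong A f≈f′) (⋉-cong A g≈g′)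
  ⋉-cong A (⨾-assoc f g h)                 = ⨾-assoc _ _ _
  ⋉-cong A (⨾-idˡ f)                       = ⨾-idˡ _
  ⋉-cong A (⨾-idʳ f)                       = ⨾-idʳ _
  ⋉-cong A (interchange X Y Z a b disjoint) = ≋⇒≈P (interchange-≋ (A ++ X) Y Z disjoint
    (⋉-whisk A X a _) (⋉-castP-whisk (C.tgt a)) (⋉-castP-whisk (C.src a)) (⋉-whisk A X a _))
    where
    ⋉-castP-whisk : ∀ U →
      (A ⋉ castP (assoc3 X U Y _) (assoc3 X U Y _) (whisk (X ++ U ++ Y) b Z))
        ≋ whisk ((A ++ X) ++ U ++ Y) b Z
    ⋉-castP-whisk U = ≋-trans (⋉-castP A (assoc3 X U Y _) (assoc3 X U Y _) _)
      (≋-trans (⋉-whisk A _ b Z) (≋-whisk b (sym (++-assoc A X (U ++ Y))) refl))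

  ⋊-cong : ∀ (A : List Obj) {B D} {f g : PTm B D} → f ≈P g → (f ⋊ A) ≈P (g ⋊ A)
  ⋊-cong A ≈P-refl                         = ≈P-refl
  ⋊-cong A (≈P-sym f≈g)                    = ≈P-sym (⋊-cong A f≈g)
  ⋊-cong A (≈P-trans f≈g g≈h)              = ≈P-trans (⋊-cong A f≈g) (⋊-cong A g≈h)
  ⋊-cong A (⨾-cong f≈f′ g≈g′)              = ⨾-cong (⋊-cong A f≈f′) (⋊-cong A g≈g′)
  ⋊-cong A (⨾-assoc f g h)                 = ⨾-assoc _ _ _
  ⋊-cong A (⨾-idˡ f)                       = ⨾-idˡ _
  ⋊-cong A (⨾-idʳ f)                       = ⨾-idʳ _
  ⋊-cong A (interchange X Y Z a b disjoint) = ≋⇒≈P (interchange-≋ X Y (Z ++ A) disjoint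
    (whisk-⋊-whisk (C.src b)) (castP-whisk-⋊ (C.tgt a)) (castP-whisk-⋊ (C.src a))
    (whisk-⋊-whisk (C.tgt b)))
    where
    whisk-⋊-whisk : ∀ U → (whisk X a (Y ++ U ++ Z) ⋊ A) ≋ whisk X a (Y ++ U ++ Z ++ A)
    whisk-⋊-whisk U = ≋-trans (whisk-⋊ X a _ A) (≋-whisk a refl (assoc3 Y U Z A))

    castP-whisk-⋊ : ∀ U →
      (castP (assoc3 X U Y _) (assoc3 X U Y _) (whisk (X ++ U ++ Y) b Z) ⋊ A)
        ≋ whisk (X ++ U ++ Y) b (Z ++ A)
    castP-whisk-⋊ U = ≋-trans (castP-⋊ A (assoc3 X U Y _) (assoc3 X U Y _) _) (whisk-⋊ _ b Z A)

  ≋-⋉ : ∀ (A : List Obj) {B D B′ D′} {f : PTm B D} {g : PTm B′ D′} →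
        f ≋ g → (A ⋉ f) ≋ (A ⋉ g)
  ≋-⋉ A (≋-by refl refl f≈g) = ≈P⇒≋ (⋉-cong A f≈g)

  ≋-⋊ : ∀ (A : List Obj) {B D B′ D′} {f : PTm B D} {g : PTm B′ D′} →
        f ≋ g → (f ⋊ A) ≋ (g ⋊ A)
  ≋-⋊ A (≋-by refl refl f≈g) = ≈P⇒≋ (⋊-cong A f≈g)

  []⋉-identity : ∀ {B D} (f : PTm B D) → ([] ⋉ f) ≋ f
  []⋉-identity (pid B)       = ≋-refl
  []⋉-identity (whisk X g Y) = ⋉-whisk [] X g Y
  []⋉-identity (f ⨾ g)       = ≋-⨾ ([]⋉-identity f) ([]⋉-identity g)

  ⋊[]-identity : ∀ {B D} (f : PTm B D) → (f ⋊ []) ≋ f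
  ⋊[]-identity (pid B)       = ≋-pid (++-identityʳ B)
  ⋊[]-identity (whisk X g Y) = ≋-trans (whisk-⋊ X g Y []) (≋-whisk g refl (++-identityʳ Y))
  ⋊[]-identity (f ⨾ g)       = ≋-⨾ (⋊[]-identity f) (⋊[]-identity g)

  ⋉-++ : ∀ (A A′ : List Obj) {B D} (f : PTm B D) → ((A ++ A′) ⋉ f) ≋ (A ⋉ (A′ ⋉ f))
  ⋉-++ A A′ (pid B)       = ≋-pid (++-assoc A A′ B)
  ⋉-++ A A′ (whisk X g Y) = let open ≋-Reasoning in
    (A ++ A′) ⋉ whisk X g Y    ≋⟨ ⋉-whisk (A ++ A′) X g Y ⟩
    whisk ((A ++ A′) ++ X) g Y ≋⟨ ≋-whisk g (++-assoc A A′ X) refl ⟩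
    whisk (A ++ A′ ++ X) g Y   ≋˘⟨ ⋉-whisk A (A′ ++ X) g Y ⟩
    A ⋉ whisk (A′ ++ X) g Y    ≋˘⟨ ≋-⋉ A (⋉-whisk A′ X g Y) ⟩
    A ⋉ (A′ ⋉ whisk X g Y)     ∎
  ⋉-++ A A′ (f ⨾ g)       = ≋-⨾ (⋉-++ A A′ f) (⋉-++ A A′ g)

  ⋊-++ : ∀ {B D} (f : PTm B D) (A A′ : List Obj) → (f ⋊ (A ++ A′)) ≋ ((f ⋊ A) ⋊ A′)
  ⋊-++ (pid B)       A A′ = ≋-pid (sym (++-assoc B A A′))
  ⋊-++ (whisk X g Y) A A′ = let open ≋-Reasoning in
    whisk X g Y ⋊ (A ++ A′)    ≋⟨ whisk-⋊ X g Y (A ++ A′) ⟩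
    whisk X g (Y ++ A ++ A′)   ≋˘⟨ ≋-whisk g refl (++-assoc Y A A′) ⟩
    whisk X g ((Y ++ A) ++ A′) ≋˘⟨ whisk-⋊ X g (Y ++ A) A′ ⟩
    whisk X g (Y ++ A) ⋊ A′    ≋˘⟨ ≋-⋊ A′ (whisk-⋊ X g Y A) ⟩
    (whisk X g Y ⋊ A) ⋊ A′     ∎
  ⋊-++ (f ⨾ g)       A A′ = ≋-⨾ (⋊-++ f A A′) (⋊-++ g A A′)

  ⋉-⋊-assoc : ∀ (A : List Obj) {B D} (f : PTm B D) (A′ : List Obj) →
              ((A ⋉ f) ⋊ A′) ≋ (A ⋉ (f ⋊ A′))
  ⋉-⋊-assoc A (pid B)       A′ = ≋-pid (++-assoc A B A′)
  ⋉-⋊-assoc A (whisk X g Y) A′ = let open ≋-Reasoning in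
    (A ⋉ whisk X g Y) ⋊ A′     ≋⟨ ≋-⋊ A′ (⋉-whisk A X g Y) ⟩
    whisk (A ++ X) g Y ⋊ A′    ≋⟨ whisk-⋊ (A ++ X) g Y A′ ⟩
    whisk (A ++ X) g (Y ++ A′) ≋˘⟨ ⋉-whisk A X g (Y ++ A′) ⟩
    A ⋉ whisk X g (Y ++ A′)    ≋˘⟨ ≋-⋉ A (whisk-⋊ X g Y A′) ⟩
    A ⋉ (whisk X g Y ⋊ A′)     ∎
  ⋉-⋊-assoc A (f ⨾ g)       A′ = ≋-⨾ (⋉-⋊-assoc A f A′) (⋉-⋊-assoc A g A′)

  glue-squares : ∀ {P Q R S U W : List Obj}
    {x₁ : PTm P Q} {x₂ : PTm Q R} {y : PTm R S} {y′ : PTm Q U}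
    {x₂′ : PTm U S} {y″ : PTm P W} {x₁′ : PTm W U} →
    (x₂ ⨾ y) ≈P (y′ ⨾ x₂′) → (x₁ ⨾ y′) ≈P (y″ ⨾ x₁′) →
    ((x₁ ⨾ x₂) ⨾ y) ≈P (y″ ⨾ (x₁′ ⨾ x₂′))
  glue-squares {x₁ = x₁} {x₂} {y} {y′} {x₂′} {y″} {x₁′} right left = begin
    (x₁ ⨾ x₂) ⨾ y     ≈⟨ ⨾-assoc x₁ x₂ y ⟩
    x₁ ⨾ (x₂ ⨾ y)     ≈⟨ ⨾-cong ≈P-refl right ⟩
    x₁ ⨾ (y′ ⨾ x₂′)   ≈⟨ ≈P-sym (⨾-assoc x₁ y′ x₂′) ⟩
    (x₁ ⨾ y′) ⨾ x₂′   ≈⟨ ⨾-cong left ≈P-refl ⟩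
    (y″ ⨾ x₁′) ⨾ x₂′  ≈⟨ ⨾-assoc y″ x₁′ x₂′ ⟩
    y″ ⨾ (x₁′ ⨾ x₂′)  ∎
    where open ≋-Reasoning

  ⨾-swap-middle : ∀ {P Q R S T U : List Obj}
    {a : PTm P Q} {b : PTm Q R} {c : PTm R S} {d : PTm S T} {c′ : PTm Q U} {b′ : PTm U S} →
    (b ⨾ c) ≈P (c′ ⨾ b′) → ((a ⨾ b) ⨾ (c ⨾ d)) ≈P ((a ⨾ c′) ⨾ (b′ ⨾ d))
  ⨾-swap-middle {a = a} {b} {c} {d} {c′} {b′} bc≈c′b′ = begin
    (a ⨾ b) ⨾ (c ⨾ d)    ≈⟨ ⨾-assoc a b (c ⨾ d) ⟩
    a ⨾ (b ⨾ (c ⨾ d))    ≈⟨ ⨾-cong ≈P-refl (≈P-sym (⨾-assoc b c d)) ⟩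
    a ⨾ ((b ⨾ c) ⨾ d)    ≈⟨ ⨾-cong ≈P-refl (⨾-cong bc≈c′b′ ≈P-refl) ⟩
    a ⨾ ((c′ ⨾ b′) ⨾ d)  ≈⟨ ⨾-cong ≈P-refl (⨾-assoc c′ b′ d) ⟩
    a ⨾ (c′ ⨾ (b′ ⨾ d))  ≈⟨ ≈P-sym (⨾-assoc a c′ (b′ ⨾ d)) ⟩
    (a ⨾ c′) ⨾ (b′ ⨾ d)  ∎
    where open ≋-Reasoning

  Interchange-pidˡ : ∀ (A : List Obj) {A′ B′} (g : PTm A′ B′) → Interchange (pid A) g
  Interchange-pidˡ A g = ≈P-trans (⨾-idˡ _) (≈P-sym (⨾-idʳ _)) ,
                         ≈P-trans (⨾-idʳ _) (≈P-sym (⨾-idˡ _))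

  Interchange-⨾ˡ : ∀ {A B D A′ B′} (f₁ : PTm A B) (f₂ : PTm B D) (g : PTm A′ B′) →
                   Interchange f₁ g → Interchange f₂ g → Interchange (f₁ ⨾ f₂) g
  Interchange-⨾ˡ f₁ f₂ g (f₁g , gf₁) (f₂g , gf₂) =
    glue-squares f₂g f₁g , ≈P-sym (glue-squares (≈P-sym gf₂) (≈P-sym gf₁))

  whisk-interchange : ∀ {a b} → Empty (C.dev a ∩ C.dev b) →
                      ∀ X Y X′ Y′ → Interchange (whisk X a Y) (whisk X′ b Y′)
  whisk-interchange disjoint X Y X′ Y′ =
    half disjoint X Y X′ Y′ , half (λ d → disjoint d ∘ swap) X′ Y′ X Y
    where
    -- The two sides are the interchange axiom for X ▷ a ◁ (Y ++ X′ ++ src b ++ Y′)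
    -- and (X ++ tgt a ++ Y ++ X′) ▷ b ◁ Y′, up to transport.
    half : ∀ {a b} → Empty (C.dev a ∩ C.dev b) → ∀ X Y X′ Y′ →
           ((whisk X a Y ⋊ (X′ ++ C.src b ++ Y′)) ⨾ ((X ++ C.tgt a ++ Y) ⋉ whisk X′ b Y′))
           ≈P (((X ++ C.src a ++ Y) ⋉ whisk X′ b Y′) ⨾ (whisk X a Y ⋊ (X′ ++ C.tgt b ++ Y′)))
    half {a} {b} disjoint X Y X′ Y′ = ≋⇒≈P (interchange-≋ X (Y ++ X′) Y′ disjoint
      (whisk-⋊-whisk (C.src b)) (⋉-whisk-whisk (C.tgt a))
      (⋉-whisk-whisk (C.src a)) (whisk-⋊-whisk (C.tgt b)))
      where
      whisk-⋊-whisk : ∀ U → (whisk X a Y ⋊ (X′ ++ U ++ Y′)) ≋ whisk X a ((Y ++ X′) ++ U ++ Y′)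
      whisk-⋊-whisk U = ≋-trans (whisk-⋊ X a Y _) (≋-whisk a refl (sym (++-assoc Y X′ _)))

      ⋉-whisk-whisk : ∀ U → ((X ++ U ++ Y) ⋉ whisk X′ b Y′) ≋ whisk (X ++ U ++ Y ++ X′) b Y′
      ⋉-whisk-whisk U = ≋-trans (⋉-whisk _ X′ b Y′) (≋-whisk b (assoc3 X U Y X′) refl)

  Central : ∀ {A B} → PTm A B → Set
  Central f = ∀ {A′ B′} (g : PTm A′ B′) → Interchange f g

  central-if-whisk : ∀ {A B} (f : PTm A B) →
                     (∀ X b Y → Interchange f (whisk X b Y)) → Central f
  central-if-whisk f f-whisk (pid A)       = swap (Interchange-pidˡ A f)
  central-if-whisk f f-whisk (whisk X b Y) = f-whisk X b Y
  central-if-whisk f f-whisk (g₁ ⨾ g₂)     = swap (Interchange-⨾ˡ g₁ g₂ f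
    (swap (central-if-whisk f f-whisk g₁)) (swap (central-if-whisk f f-whisk g₂)))

  whisk-central : ∀ {a} X Y → Empty (C.dev a) → Central (whisk X a Y)
  whisk-central {a} X Y no-devices = central-if-whisk (whisk X a Y) λ X′ b Y′ →
    whisk-interchange (λ d → no-devices d ∘ proj₁) X Y X′ Y′

  central-castP : ∀ {A B A′ B′} (p : A ≡ A′) (q : B ≡ B′) (f : PTm A B) →
                  Central f → Central (castP p q f)
  central-castP refl refl f f-central = f-central

  central-⨾ : ∀ {A B D} (f₁ : PTm A B) (f₂ : PTm B D) →
              Central f₁ → Central f₂ → Central (f₁ ⨾ f₂)
  central-⨾ f₁ f₂ f₁-central f₂-central g =
    Interchange-⨾ˡ f₁ f₂ g (f₁-central g) (f₂-central g)

  central-⋉ : ∀ (A : List Obj) {A₀ B} (f : PTm A₀ B) → Central f → Central (A ⋉ f)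
  central-⋉ A {A₀} {B} f f-central {A′} {B′} g = first , second
    where
    open ≋-Reasoning
    first : (((A ⋉ f) ⋊ A′) ⨾ ((A ++ B) ⋉ g)) ≈P (((A ++ A₀) ⋉ g) ⨾ ((A ⋉ f) ⋊ B′))
    first = begin
      ((A ⋉ f) ⋊ A′) ⨾ ((A ++ B) ⋉ g)  ≋⟨ ≋-⨾ (⋉-⋊-assoc A f A′) (⋉-++ A B g) ⟩
      A ⋉ ((f ⋊ A′) ⨾ (B ⋉ g))         ≈⟨ ⋉-cong A (proj₁ (f-central g)) ⟩
      A ⋉ ((A₀ ⋉ g) ⨾ (f ⋊ B′))        ≋˘⟨ ≋-⨾ (⋉-++ A A₀ g) (⋉-⋊-assoc A f B′) ⟩
      ((A ++ A₀) ⋉ g) ⨾ ((A ⋉ f) ⋊ B′)  ∎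
    second : ((g ⋊ (A ++ A₀)) ⨾ (B′ ⋉ (A ⋉ f))) ≈P ((A′ ⋉ (A ⋉ f)) ⨾ (g ⋊ (A ++ B)))
    second = begin
      (g ⋊ (A ++ A₀)) ⨾ (B′ ⋉ (A ⋉ f))  ≋⟨ ≋-⨾ (⋊-++ g A A₀) (≋-sym (⋉-++ B′ A f)) ⟩
      ((g ⋊ A) ⋊ A₀) ⨾ ((B′ ++ A) ⋉ f)  ≈⟨ proj₂ (f-central (g ⋊ A)) ⟩
      ((A′ ++ A) ⋉ f) ⨾ ((g ⋊ A) ⋊ B)   ≋⟨ ≋-⨾ (⋉-++ A′ A f) (≋-sym (⋊-++ g A B)) ⟩
      (A′ ⋉ (A ⋉ f)) ⨾ (g ⋊ (A ++ B))   ∎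

  central-⋊ : ∀ {A₀ B} (f : PTm A₀ B) (A : List Obj) → Central f → Central (f ⋊ A)
  central-⋊ {A₀} {B} f A f-central {A′} {B′} g = first , second
    where
    open ≋-Reasoning
    first : (((f ⋊ A) ⋊ A′) ⨾ ((B ++ A) ⋉ g)) ≈P (((A₀ ++ A) ⋉ g) ⨾ ((f ⋊ A) ⋊ B′))
    first = begin
      ((f ⋊ A) ⋊ A′) ⨾ ((B ++ A) ⋉ g)  ≋˘⟨ ≋-⨾ (⋊-++ f A A′) (≋-sym (⋉-++ B A g)) ⟩
      (f ⋊ (A ++ A′)) ⨾ (B ⋉ (A ⋉ g))  ≈⟨ proj₁ (f-central (A ⋉ g)) ⟩
      (A₀ ⋉ (A ⋉ g)) ⨾ (f ⋊ (A ++ B′)) ≋˘⟨ ≋-⨾ (⋉-++ A₀ A g) (≋-sym (⋊-++ f A B′)) ⟩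
      ((A₀ ++ A) ⋉ g) ⨾ ((f ⋊ A) ⋊ B′)  ∎
    second : ((g ⋊ (A₀ ++ A)) ⨾ (B′ ⋉ (f ⋊ A))) ≈P ((A′ ⋉ (f ⋊ A)) ⨾ (g ⋊ (B ++ A)))
    second = begin
      (g ⋊ (A₀ ++ A)) ⨾ (B′ ⋉ (f ⋊ A))   ≋⟨ ≋-⨾ (⋊-++ g A₀ A) (≋-sym (⋉-⋊-assoc B′ f A)) ⟩
      ((g ⋊ A₀) ⋊ A) ⨾ ((B′ ⋉ f) ⋊ A)    ≈⟨ ⋊-cong A (proj₂ (f-central g)) ⟩
      ((A′ ⋉ f) ⋊ A) ⨾ ((g ⋊ B) ⋊ A)     ≋⟨ ≋-⨾ (⋉-⋊-assoc A′ f A) (≋-sym (⋊-++ g B A)) ⟩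
      (A′ ⋉ (f ⋊ A)) ⨾ (g ⋊ (B ++ A))    ∎

  𝓕𝒢-central : ∀ {A B} (f : Tm A B) → Central (𝓕𝒢 f)
  𝓕𝒢-central (gen v)  = central-castP
    (trans (++-identityʳ (C.src (G v))) (G-src v)) (trans (++-identityʳ (C.tgt (G v))) (G-tgt v))
    (whisk [] (G v) []) (whisk-central [] [] (G-dev v))
  𝓕𝒢-central (id A)   = Interchange-pidˡ A
  𝓕𝒢-central (f ⨟ g)  = central-⨾ (𝓕𝒢 f) (𝓕𝒢 g) (𝓕𝒢-central f) (𝓕𝒢-central g)
  𝓕𝒢-central (_⊗_ {B = B₁} {A′ = A₂} f g) = central-⨾ (𝓕𝒢 f ⋊ A₂) (B₁ ⋉ 𝓕𝒢 g)
    (central-⋊ (𝓕𝒢 f) A₂ (𝓕𝒢-central f)) (central-⋉ B₁ (𝓕𝒢 g) (𝓕𝒢-central g))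

  𝓕𝒢-cast : ∀ {A B A′ B′} (p : A ≡ A′) (q : B ≡ B′) (f : Tm A B) → 𝓕𝒢 (cast p q f) ≋ 𝓕𝒢 f
  𝓕𝒢-cast refl refl f = ≋-refl

  𝓕𝒢-cong : ∀ {A B} {f g : Tm A B} → f ≈ g → 𝓕𝒢 f ≈P 𝓕𝒢 g
  𝓕𝒢-cong ≈-refl             = ≈P-refl
  𝓕𝒢-cong (≈-sym f≈g)        = ≈P-sym (𝓕𝒢-cong f≈g)
  𝓕𝒢-cong (≈-trans f≈g g≈h)  = ≈P-trans (𝓕𝒢-cong f≈g) (𝓕𝒢-cong g≈h)
  𝓕𝒢-cong (⨟-cong f≈f′ g≈g′) = ⨾-cong (𝓕𝒢-cong f≈f′) (𝓕𝒢-cong g≈g′)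
  𝓕𝒢-cong (⊗-cong {B = B} {A′ = A′} f≈f′ g≈g′) =
    ⨾-cong (⋊-cong A′ (𝓕𝒢-cong f≈f′)) (⋉-cong B (𝓕𝒢-cong g≈g′))
  𝓕𝒢-cong (⨟-assoc f g h)    = ⨾-assoc _ _ _
  𝓕𝒢-cong (⨟-idˡ f)          = ⨾-idˡ _
  𝓕𝒢-cong (⨟-idʳ f)          = ⨾-idʳ _
  𝓕𝒢-cong (⊗-id A B)         = ⨾-idˡ _
  𝓕𝒢-cong (⊗-⨟ f g f′ g′)    = ⨾-swap-middle (proj₂ (𝓕𝒢-central f′ (𝓕𝒢 g)))
  𝓕𝒢-cong (⊗-assoc {A} {B} {A′} {B′} {A″} {B″} f g h) = begin
    𝓕𝒢 (cast (++-assoc A A′ A″) (++-assoc B B′ B″) ((f ⊗ g) ⊗ h))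
      ≋⟨ 𝓕𝒢-cast (++-assoc A A′ A″) (++-assoc B B′ B″) ((f ⊗ g) ⊗ h) ⟩
    (((𝓕𝒢 f ⋊ A′) ⋊ A″) ⨾ ((B ⋉ 𝓕𝒢 g) ⋊ A″)) ⨾ ((B ++ B′) ⋉ 𝓕𝒢 h)
      ≈⟨ ⨾-assoc _ _ _ ⟩
    ((𝓕𝒢 f ⋊ A′) ⋊ A″) ⨾ (((B ⋉ 𝓕𝒢 g) ⋊ A″) ⨾ ((B ++ B′) ⋉ 𝓕𝒢 h))
      ≋˘⟨ ≋-⨾ (⋊-++ (𝓕𝒢 f) A′ A″)
              (≋-⨾ (≋-sym (⋉-⋊-assoc B (𝓕𝒢 g) A″)) (≋-sym (⋉-++ B B′ (𝓕𝒢 h)))) ⟩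
    (𝓕𝒢 f ⋊ (A′ ++ A″)) ⨾ ((B ⋉ (𝓕𝒢 g ⋊ A″)) ⨾ (B ⋉ (B′ ⋉ 𝓕𝒢 h)))
      ∎
    where open ≋-Reasoning
  𝓕𝒢-cong (⊗-unitˡ f)        = ≈P-trans (⨾-idˡ _) (≋⇒≈P ([]⋉-identity (𝓕𝒢 f)))
  𝓕𝒢-cong (⊗-unitʳ {A} {B} f) = begin
    𝓕𝒢 (cast (++-identityʳ A) (++-identityʳ B) (f ⊗ id []))
      ≋⟨ 𝓕𝒢-cast (++-identityʳ A) (++-identityʳ B) (f ⊗ id []) ⟩
    (𝓕𝒢 f ⋊ []) ⨾ pid (B ++ [])  ≈⟨ ⨾-idʳ _ ⟩
    𝓕𝒢 f ⋊ []                    ≋⟨ ⋊[]-identity (𝓕𝒢 f) ⟩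
    𝓕𝒢 f                         ∎
    where open ≋-Reasoning

proposition3p25 : (𝒢 : EffectfulGraph) → Free.IsEffectfulCategory 𝒢
proposition3p25 𝒢 = record
  { well-defined = 𝓕𝒢-cong 𝒢
  ; pres-id      = λ A → ≈P-refl
  ; pres-comp    = λ f g → ≈P-refl
  ; pres-⋉       = λ A f → ⨾-idˡ _
  ; pres-⋊       = λ f A → ⨾-idʳ _
  ; central      = λ f → 𝓕𝒢-central 𝒢 f
  }
  where open Free 𝒢
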